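{- Let $G=(V,E)$ be a finite undirected graph and let $\phi=(\phi_1,\phi_2):E\to\{(0,1),(1,0),(1,1)\}\subseteq\mathbb{Z}_2\times\mathbb{Z}_2$ be any nowhere-zero map. Let $a_e=(-1)^{\phi_1(e)}$ and $b_e=(-1)^{\phi_2(e)}$ for $e\in E$. If $\phi$ is a four-flow on $G$ then $f_G(a,b)=4^{|V|}$; otherwise $f_G(a,b)=0$.
   Context: $\delta(v)$ is the set of edges incident to $v$. A four-flow is a map $\phi:E\to\mathbb{Z}_2\times\mathbb{Z}_2$ with $\sum_{e\in\delta(v)}\phi(e)=(0,0)$ for every vertex $v$. $f_G:=\prod_{v\in V}\Big(\prod_{e\in\delta(v)}x_e+1\Big)\Big(\prod_{e\in\delta(v)}y_e+1\Big)\in\mathbb{C}[x_e,y_e:e\in E]$. -}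

module Defs where

open import Data.Nat using (ℕ)
open import Data.Fin using (Fin; _≟_)
open import Data.Bool using (Bool; true; false; _xor_; if_then_else_)
open import Data.Product using (_×_; _,_; proj₁; proj₂)
open import Data.Sum using (_⊎_)
open import Data.List using (List; foldr)
import Data.List as L
open import Data.Integer using (ℤ; +_; -_; _*_; _+_)
open import Relation.Binary.PropositionalEquality using (_≡_)
open import Relation.Nullary using (¬_)
open import Relation.Nullary.Decidable using (Dec; _⊎-dec_; does)

-- A finite undirected (multi)graph with vertex set Fin n and edge set Fin m;
-- each edge e has an (unordered) pair of endpoints given by ends e.
record Graph : Set where
  field
    n    : ℕ
    m    : ℕ
    ends : Fin m → Fin n × Fin n

open Graph public

V : Graph → Set
V G = Fin (n G)

E : Graph → Set
E G = Fin (m G)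

Incident : (G : Graph) → V G → E G → Set
Incident G v e = (proj₁ (ends G e) ≡ v) ⊎ (proj₂ (ends G e) ≡ v)

incident? : (G : Graph) (v : V G) (e : E G) → Dec (Incident G v e)
incident? G v e = (proj₁ (ends G e) ≟ v) ⊎-dec (proj₂ (ends G e) ≟ v)

Z2×Z2 : Set
Z2×Z2 = Bool × Bool

zero₄ : Z2×Z2
zero₄ = (false , false)

_⊕_ : Z2×Z2 → Z2×Z2 → Z2×Z2
(a , b) ⊕ (c , d) = (a xor c , b xor d)

sumδ : (G : Graph) → V G → (E G → Z2×Z2) → Z2×Z2
sumδ G v φ = foldr (λ e acc → if does (incident? G v e) then φ e ⊕ acc else acc)
                   zero₄ (L.allFin (m G))

prodδ : (G : Graph) → V G → (E G → ℤ) → ℤ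
prodδ G v x = foldr (λ e acc → if does (incident? G v e) then x e * acc else acc)
                    (+ 1) (L.allFin (m G))

NowhereZero : (G : Graph) → (E G → Z2×Z2) → Set
NowhereZero G φ = ∀ e → ¬ (φ e ≡ zero₄)

IsFourFlow : (G : Graph) → (E G → Z2×Z2) → Set
IsFourFlow G φ = ∀ v → sumδ G v φ ≡ zero₄

-- evaluation of f_G = ∏_v (∏_{e∈δ(v)} x_e + 1)(∏_{e∈δ(v)} y_e + 1) at (x, y)
-- (the point values are integers, so we evaluate in ℤ ⊆ ℂ)
evalfG : (G : Graph) → (E G → ℤ) → (E G → ℤ) → ℤ
evalfG G x y = foldr (λ v acc → ((prodδ G v x + + 1) * (prodδ G v y + + 1)) * acc)
                     (+ 1) (L.allFin (n G))

signZ2 : Bool → ℤ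
signZ2 false = + 1
signZ2 true  = - (+ 1)

-- The maps χ₁(p) = (-1)^{p₁} and χ₂(p) = (-1)^{p₂} are characters of Z₂ × Z₂, so at the point
-- (a, b) the product ∏_{e∈δ(v)} a_e is χ₁ of the flow sum s_v = ∑_{e∈δ(v)} φ(e), and likewise
-- for b. Hence the factor of f_G at v is (χ₁(s_v) + 1)(χ₂(s_v) + 1), which is 4 if s_v = 0
-- and 0 otherwise (one of the characters takes the value -1 on s_v).
module Submission where

open import Defs
open import Data.Nat using (_^_)
open import Data.Integer using (ℤ; +_; _*_; _+_)
open import Data.Integer.Properties using (pos-*; *-zeroʳ)
open import Data.Bool using (Bool; true; false; _xor_; if_then_else_)
import Data.Bool.Properties as Bool
open import Data.Product using (_×_; _,_; proj₁; proj₂)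
open import Data.Product.Properties using (≡-dec)
open import Data.Fin.Properties using (¬∀⟶∃¬)
open import Data.List using (List; []; _∷_; foldr; length; allFin)
open import Data.List.Properties using (length-tabulate)
open import Data.List.Membership.Propositional using (_∈_)
open import Data.List.Membership.Propositional.Properties using (∈-allFin)
open import Data.List.Relation.Unary.Any using (here; there)
open import Relation.Nullary using (¬_)
open import Relation.Nullary.Decidable using (Dec; does)
open import Relation.Binary.PropositionalEquality using (_≡_; _≢_; refl; cong; cong₂; sym; trans)
open Relation.Binary.PropositionalEquality.≡-Reasoning

_≟₄_ : (p q : Z2×Z2) → Dec (p ≡ q)
_≟₄_ = ≡-dec Bool._≟_ Bool._≟_

signZ2-xor : ∀ a b → signZ2 (a xor b) ≡ signZ2 a * signZ2 b
signZ2-xor false false = refl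
signZ2-xor false true  = refl
signZ2-xor true  false = refl
signZ2-xor true  true  = refl

IsCharacter : (Z2×Z2 → ℤ) → Set
IsCharacter χ = χ zero₄ ≡ + 1 × (∀ p q → χ (p ⊕ q) ≡ χ p * χ q)

χ₁ χ₂ : Z2×Z2 → ℤ
χ₁ p = signZ2 (proj₁ p)
χ₂ p = signZ2 (proj₂ p)

χ₁-isCharacter : IsCharacter χ₁
χ₁-isCharacter = refl , λ p q → signZ2-xor (proj₁ p) (proj₁ q)

χ₂-isCharacter : IsCharacter χ₂
χ₂-isCharacter = refl , λ p q → signZ2-xor (proj₂ p) (proj₂ q)

module _ {A : Set} (keep : A → Bool) (φ : A → Z2×Z2) where

  filteredSum : List A → Z2×Z2
  filteredSum = foldr (λ e acc → if keep e then φ e ⊕ acc else acc) zero₄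

  filteredProduct : (A → ℤ) → List A → ℤ
  filteredProduct z = foldr (λ e acc → if keep e then z e * acc else acc) (+ 1)

  filteredProduct-character : ∀ χ → IsCharacter χ → ∀ l →
    filteredProduct (λ e → χ (φ e)) l ≡ χ (filteredSum l)
  filteredProduct-character χ (χ-zero , χ-hom) [] = sym χ-zero
  filteredProduct-character χ isχ@(_ , χ-hom) (e ∷ l) with keep e
  ... | true  = begin
    χ (φ e) * filteredProduct (λ e → χ (φ e)) l ≡⟨ cong (χ (φ e) *_) (filteredProduct-character χ isχ l) ⟩
    χ (φ e) * χ (filteredSum l)                 ≡⟨ sym (χ-hom (φ e) (filteredSum l)) ⟩
    χ (φ e ⊕ filteredSum l)                     ∎
  ... | false = filteredProduct-character χ isχ l

vertexFactor : Z2×Z2 → ℤ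
vertexFactor s = (χ₁ s + + 1) * (χ₂ s + + 1)

vertexFactor-nonzero : ∀ s → s ≢ zero₄ → vertexFactor s ≡ + 0
vertexFactor-nonzero (false , false) s≢0 with () ← s≢0 refl
vertexFactor-nonzero (false , true)  _ = refl
vertexFactor-nonzero (true  , false) _ = refl
vertexFactor-nonzero (true  , true)  _ = refl

module _ {A : Set} (f : A → ℤ) where

  product : List A → ℤ
  product = foldr (λ a acc → f a * acc) (+ 1)

  product-const : ∀ c → (∀ a → f a ≡ + c) → ∀ l → product l ≡ + (c ^ length l)
  product-const c f≡c []      = refl
  product-const c f≡c (a ∷ l) = begin
    f a * product l            ≡⟨ cong₂ _*_ (f≡c a) (product-const c f≡c l) ⟩
    + c * + (c ^ length l)     ≡⟨ sym (pos-* c (c ^ length l)) ⟩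
    + (c ^ length (a ∷ l))     ∎

  product-zero : ∀ {a l} → a ∈ l → f a ≡ + 0 → product l ≡ + 0
  product-zero {a} {l = _ ∷ l} (here refl) fa≡0 = cong (_* product l) fa≡0
  product-zero {l = b ∷ _} (there a∈l) fa≡0 =
    trans (cong (f b *_) (product-zero a∈l fa≡0)) (*-zeroʳ (f b))

module _ (G : Graph) (φ : E G → Z2×Z2) where

  a b : E G → ℤ
  a e = signZ2 (proj₁ (φ e))
  b e = signZ2 (proj₂ (φ e))

  fG-factor : V G → ℤ
  fG-factor v = (prodδ G v a + + 1) * (prodδ G v b + + 1)

  fG-factor≡vertexFactor : ∀ v → fG-factor v ≡ vertexFactor (sumδ G v φ)
  fG-factor≡vertexFactor v = cong₂ (λ x y → (x + + 1) * (y + + 1))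
    (filteredProduct-character keep φ χ₁ χ₁-isCharacter (allFin (m G)))
    (filteredProduct-character keep φ χ₂ χ₂-isCharacter (allFin (m G)))
    where
    keep : E G → Bool
    keep e = does (incident? G v e)

proposition4p3 : (G : Graph) (φ : E G → Z2×Z2) → NowhereZero G φ →
    (IsFourFlow G φ →
       evalfG G (λ e → signZ2 (proj₁ (φ e))) (λ e → signZ2 (proj₂ (φ e))) ≡ + (4 ^ n G))
    × (¬ IsFourFlow G φ →
       evalfG G (λ e → signZ2 (proj₁ (φ e))) (λ e → signZ2 (proj₂ (φ e))) ≡ + 0)
proposition4p3 G φ _ = flow , nonFlow
  where
  flow : IsFourFlow G φ → product (fG-factor G φ) (allFin (n G)) ≡ + (4 ^ n G)
  flow isFlow = begin
    product (fG-factor G φ) (allFin (n G)) ≡⟨ product-const (fG-factor G φ) 4 factor≡4 (allFin (n G)) ⟩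
    + (4 ^ length (allFin (n G)))          ≡⟨ cong (λ k → + (4 ^ k)) (length-tabulate {n = n G} (λ i → i)) ⟩
    + (4 ^ n G)                            ∎
    where
    factor≡4 : ∀ v → fG-factor G φ v ≡ + 4
    factor≡4 v = trans (fG-factor≡vertexFactor G φ v) (cong vertexFactor (isFlow v))

  nonFlow : ¬ IsFourFlow G φ → product (fG-factor G φ) (allFin (n G)) ≡ + 0
  nonFlow notFlow with v , sv≢0 ← ¬∀⟶∃¬ (n G) _ (λ v → sumδ G v φ ≟₄ zero₄) notFlow =
    product-zero (fG-factor G φ) (∈-allFin v)
      (trans (fG-factor≡vertexFactor G φ v) (vertexFactor-nonzero (sumδ G v φ) sv≢0))
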